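{- For every $i\in\mathbb Z^{\geq 0}$ and every $j\in\mathbb Z$, $$R_{i,j}=R_{i+1,F(i+1)+j}\cup R_{i+2,j},$$ and this union is disjoint, i.e. $R_{i+1,F(i+1)+j}\cap R_{i+2,j}=\emptyset$.
   Context: Let $\varphi=\frac{1+\sqrt5}{2}$ and $\mathbb N=\{1,2,3,\dots\}$. For $n\in\mathbb N$ put $a(n)=\lfloor n\varphi\rfloor$ and $b(n)=\lfloor n\varphi^2\rfloor$. $F$ denotes the Fibonacci sequence, $F(0)=0$, $F(1)=F(2)=1$, $F(n)=F(n-1)+F(n-2)$. For $i\in\mathbb Z^{\geq 0}=\{0,1,2,\dots\}$ and $j\in\mathbb Z$ define the sequence $f_{i,j}(n)=F(i+1)a(n)+F(i)n-j$ for $n\in\mathbb N$, and let $R_{i,j}=\{f_{i,j}(n)\mid n\in\mathbb N\}$ be its range. -}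

module Defs where

open import Data.Nat as ℕ using (ℕ; zero; suc; _∸_)
open import Data.Bool using (Bool; true; false; _∨_)
open import Data.List using (List; upTo; map; filterᵇ; length)
open import Data.Integer as ℤ using (ℤ; +_)
open import Data.Product using (∃-syntax; _×_)

-- Golden ratio φ = (1+√5)/2 (no reals available).
-- For m, n : ℕ we have  m ≤ nφ  ⇔  2m - n ≤ n√5
--                        ⇔  2m ≤ n  or  (2m - n)² ≤ 5n².
le-nφ : ℕ → ℕ → Bool
le-nφ m n = (2 ℕ.* m ℕ.≤ᵇ n) ∨ ((2 ℕ.* m ∸ n) ℕ.* (2 ℕ.* m ∸ n) ℕ.≤ᵇ 5 ℕ.* n ℕ.* n)

-- a(n) = ⌊nφ⌋ : since 0 ≤ nφ < 2n+1 and {m | m ≤ nφ} is downward closed,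
-- ⌊nφ⌋ = #{ m ∈ {1,…,2n} | m ≤ nφ }.
a : ℕ → ℕ
a n = length (filterᵇ (λ m → le-nφ m n) (map suc (upTo (2 ℕ.* n))))

F : ℕ → ℕ
F zero = 0
F (suc zero) = 1
F (suc (suc n)) = F (suc n) ℕ.+ F n

f : ℕ → ℤ → ℕ → ℤ
f i j n = + (F (suc i) ℕ.* a n ℕ.+ F i ℕ.* n) ℤ.- j

InR : ℕ → ℤ → ℤ → Set
InR i j x = ∃[ n ] (n ℕ.≥ 1 × f i j n ≡ x)
  where open import Relation.Binary.PropositionalEquality using (_≡_)

module Submission where

-- Write m < nφ as m² < n(m + n) and nφ < m as n(m + n) < m²; one of the two holds for n ≥ 1 since φ is
-- irrational. The substitution (m, n) ↦ (m + n, m), i.e. multiplication by φ, exchanges the two inequalities.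
-- Applied to a(n) < nφ < a(n) + 1 it gives a(a(n)) = a(n) + n − 1 and a(b(n)) = b(n) + a(n) for
-- b(n) = a(n) + n, and it shows that the ranges of a and b partition ℕ (Beatty). As F(i+2) = F(i+1) + F(i),
-- the two identities say f_{i,j} ∘ a = f_{i+1,F(i+1)+j} and f_{i,j} ∘ b = f_{i+2,j}; since f_{i,j} is
-- injective, the partition of its domain carries over to its range R_{i,j}.

open import Defs

-- A module of its own, so that the arithmetic of ℕ does not clash with that of ℤ in the statement below.
module Beatty where

  open import Data.Nat
  open import Data.Nat.Properties
  open import Data.Nat.Induction using (<-wellFounded)
  open import Data.Nat.Tactic.RingSolver using (solve; solve-∀)
  open import Data.Bool using (Bool; T)
  open import Data.Bool.Properties using (T-∨)
  open import Data.List using ([]; _∷_; _++_; length; map; upTo; filterᵇ)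
  open import Data.List.Properties using (upTo-∷ʳ; map-++; filter-++; filter-accept; filter-reject; length-++)
  open import Data.Product using (_×_; _,_; proj₁; proj₂; ∃-syntax)
  open import Data.Sum using (_⊎_; inj₁; inj₂; map₁)
  open import Function.Base using (_∘_)
  open import Function.Bundles using (_⇔_; mk⇔; Equivalence)
  open import Induction.WellFounded using (Acc; acc)
  open import Relation.Binary.Definitions using (tri<; tri≈; tri>)
  open import Relation.Binary.PropositionalEquality
  open import Relation.Nullary using (¬_; yes; no; contradiction)
  open import Relation.Nullary.Decidable using (T?)

  +-cross-≤ : ∀ {x y a b} → x + a ≡ y + b → x ≤ b → y ≤ a
  +-cross-≤ {x} {y} {a} {b} eq x≤b = +-cancelʳ-≤ b y a (begin
    y + b  ≡⟨ sym eq ⟩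
    x + a  ≤⟨ +-monoˡ-≤ a x≤b ⟩
    b + a  ≡⟨ +-comm b a ⟩
    a + b  ∎)
    where open ≤-Reasoning

  +-cross-< : ∀ {x y a b} → x + a ≡ y + b → x < b → y < a
  +-cross-< eq = +-cross-≤ (cong suc eq)

  -- nφ is the positive root of x² = n x + n², so these say m < nφ and nφ < m.
  record Below (m n : ℕ) : Set where
    constructor below
    field m²<n[m+n] : m * m < n * (m + n)

  record Above (m n : ℕ) : Set where
    constructor above
    field n[m+n]<m² : n * (m + n) < m * m

  Below-reflect : ∀ {m n} → Below (m + n) m ⇔ Above m n
  Below-reflect {m} {n} = mk⇔ (λ (below h) → above (+-cross-< eq h)) (λ (above h) → below (+-cross-< (sym eq) h))
    where
    eq : (m + n) * (m + n) + m * m ≡ n * (m + n) + m * (m + n + m)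
    eq = solve (m ∷ n ∷ [])

  Above-reflect : ∀ {m n} → Above (m + n) m ⇔ Below m n
  Above-reflect {m} {n} = mk⇔ (λ (above h) → below (+-cross-< eq h)) (λ (below h) → above (+-cross-< (sym eq) h))
    where
    eq : m * (m + n + m) + n * (m + n) ≡ m * m + (m + n) * (m + n)
    eq = solve (m ∷ n ∷ [])

  ≤⇒Below : ∀ {m n} .{{_ : NonZero n}} → m ≤ n → Below m n
  ≤⇒Below {m} {n} m≤n = below (begin-strict
    m * m          ≤⟨ *-monoˡ-≤ m m≤n ⟩
    n * m          <⟨ m<m+n (n * m) (>-nonZero⁻¹ (n * n) {{m*n≢0 n n}}) ⟩
    n * m + n * n  ≡⟨ *-distribˡ-+ n m n ⟨
    n * (m + n)    ∎)
    where open ≤-Reasoning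

  -- Irrationality of φ, by the descent (m, n) ↦ (n, m ∸ n) that preserves m² = n(m + n).
  golden-irrational : ∀ m n → m * m ≡ n * (m + n) → n ≡ 0
  golden-irrational m n = descent m n (<-wellFounded n)
    where
    descent : ∀ m n → Acc _<_ n → m * m ≡ n * (m + n) → n ≡ 0
    descent m zero _ _ = refl
    descent m N@(suc n) (acc rs) eq with m ≤? N
    ... | yes m≤N = contradiction eq (<⇒≢ (Below.m²<n[m+n] (≤⇒Below m≤N)))
    ... | no m≰N with d , refl ← m≤n⇒∃[o]m+o≡n (<⇒≤ (≰⇒> m≰N)) =
      contradiction (trans descended (cong (λ e → e * (N + e)) d≡0)) λ ()
      where
      identity : (N + d) * (N + d) + N * N ≡ N * (N + d + N) + d * (N + d)
      identity = solve (n ∷ d ∷ [])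
      descended : N * N ≡ d * (N + d)
      descended = +-cancelˡ-≡ (N * (N + d + N)) _ _ (trans (cong (_+ N * N) (sym eq)) identity)
      d<N : d < N
      d<N with N ≤? d
      ... | yes N≤d = contradiction descended (<⇒≢ (Below.m²<n[m+n] (≤⇒Below {{>-nonZero (<-≤-trans z<s N≤d)}} N≤d)))
      ... | no N≰d = ≰⇒> N≰d
      d≡0 : d ≡ 0
      d≡0 = descent N d (rs d<N) descended

  ¬Above⇒Below : ∀ {m n} .{{_ : NonZero n}} → ¬ Above m n → Below m n
  ¬Above⇒Below {m} {n} ¬m>nφ =
    below (≤∧≢⇒< (≮⇒≥ (¬m>nφ ∘ above)) (≢-nonZero⁻¹ n ∘ golden-irrational m n))

  Below⊎Above : ∀ m n .{{_ : NonZero n}} → Below m n ⊎ Above m n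
  Below⊎Above m n with n * (m + n) <? m * m
  ... | yes m>nφ = inj₂ (above m>nφ)
  ... | no m≯nφ = inj₁ (¬Above⇒Below (m≯nφ ∘ Above.n[m+n]<m²))

  Below⇒¬Above : ∀ {m n} → Below m n → ¬ Above m n
  Below⇒¬Above (below h) (above h′) = <-asym h h′

  Above⇒> : ∀ {m n} → Above m n → n < m
  Above⇒> {m} {n} (above h) = ≰⇒> λ m≤n →
    <⇒≱ h (≤-trans (*-monoˡ-≤ m m≤n) (*-monoʳ-≤ n (m≤m+n m n)))

  Above-suc : ∀ {m n} → Above m n → Above (suc m) n
  Above-suc {m} {n} m>nφ@(above h) = above (begin-strict
    n * (suc m + n)          ≡⟨ solve (m ∷ n ∷ []) ⟩
    n * (m + n) + n          <⟨ +-monoˡ-< n h ⟩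
    m * m + n                ≤⟨ +-monoʳ-≤ (m * m) (<⇒≤ (Above⇒> m>nφ)) ⟩
    m * m + m                ≤⟨ m≤m+n (m * m + m) (suc m) ⟩
    m * m + m + suc m        ≡⟨ solve (m ∷ []) ⟩
    suc m * suc m            ∎)
    where open ≤-Reasoning

  Above-monoˡ : ∀ {m m′ n} → m ≤ m′ → Above m n → Above m′ n
  Above-monoˡ m≤m′ = go (≤⇒≤′ m≤m′)
    where
    go : ∀ {m m′ n} → m ≤′ m′ → Above m n → Above m′ n
    go ≤′-refl m>nφ = m>nφ
    go (≤′-step m≤′m′) m>nφ = Above-suc (go m≤′m′ m>nφ)

  Below-monoˡ : ∀ {m m′ n} → m′ ≤ m → Below m n → Below m′ n
  Below-monoˡ {n = suc _} m′≤m m<nφ =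
    ¬Above⇒Below (Below⇒¬Above m<nφ ∘ Above-monoˡ m′≤m)

  Below-monoʳ : ∀ {m n n′} → n ≤ n′ → Below m n → Below m n′
  Below-monoʳ {m} n≤n′ (below h) = below (<-≤-trans h (*-mono-≤ n≤n′ (+-monoʳ-≤ m n≤n′)))

  Above-Below⇒< : ∀ {m d n} → Above m d → Below m n → d < n
  Above-Below⇒< m>dφ m<nφ = ≰⇒> λ n≤d → Below⇒¬Above (Below-monoʳ n≤d m<nφ) m>dφ

  Below⇒<2* : ∀ {m n} → Below m n → m < 2 * n
  Below⇒<2* {m} {n} (below h) = ≰⇒> λ 2n≤m → <⇒≱ h (begin
    n * (m + n)  ≤⟨ *-monoʳ-≤ n (+-monoʳ-≤ m (≤-trans (m≤m+n n (n + 0)) 2n≤m)) ⟩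
    n * (m + m)  ≡⟨ solve (m ∷ n ∷ []) ⟩
    2 * n * m    ≤⟨ *-monoˡ-≤ m 2n≤m ⟩
    m * m        ∎)
    where open ≤-Reasoning

  Below-suc : ∀ {m n} → Below m n → Below (suc m) (suc n)
  Below-suc {m} {n} m<nφ@(below h) = below (begin-strict
    suc m * suc m                           ≡⟨ solve (m ∷ []) ⟩
    m * m + suc (m + m)                     <⟨ +-monoˡ-< (suc (m + m)) h ⟩
    n * (m + n) + suc (m + m)               ≤⟨ +-monoʳ-≤ (n * (m + n)) (s≤s (+-monoʳ-≤ m (<⇒≤ (Below⇒<2* m<nφ)))) ⟩
    n * (m + n) + suc (m + 2 * n)           ≤⟨ +-monoʳ-≤ (n * (m + n)) (m≤m+n (suc (m + 2 * n)) (suc n)) ⟩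
    n * (m + n) + (suc (m + 2 * n) + suc n) ≡⟨ solve (m ∷ n ∷ []) ⟩
    suc n * (suc m + suc n)                 ∎)
    where open ≤-Reasoning

  count : (ℕ → Bool) → ℕ → ℕ
  count p K = length (filterᵇ p (map suc (upTo K)))

  count-suc : ∀ p K → count p (suc K) ≡ count p K + length (filterᵇ p (suc K ∷ []))
  count-suc p K = begin
    length (filterᵇ p (map suc (upTo (suc K))))            ≡⟨ cong (length ∘ filterᵇ p ∘ map suc) (upTo-∷ʳ K) ⟨
    length (filterᵇ p (map suc (upTo K ++ K ∷ [])))          ≡⟨ cong (length ∘ filterᵇ p) (map-++ suc (upTo K) (K ∷ [])) ⟩
    length (filterᵇ p (map suc (upTo K) ++ suc K ∷ []))      ≡⟨ cong length (filter-++ (T? ∘ p) (map suc (upTo K)) (suc K ∷ [])) ⟩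
    length (filterᵇ p (map suc (upTo K)) ++ filterᵇ p (suc K ∷ [])) ≡⟨ length-++ (filterᵇ p (map suc (upTo K))) ⟩
    count p K + length (filterᵇ p (suc K ∷ []))              ∎
    where open ≡-Reasoning

  count-accept : ∀ {p K} → T (p (suc K)) → count p (suc K) ≡ suc (count p K)
  count-accept {p} {K} pK = begin
    count p (suc K)                               ≡⟨ count-suc p K ⟩
    count p K + length (filterᵇ p (suc K ∷ []))   ≡⟨ cong (λ xs → count p K + length xs) (filter-accept (T? ∘ p) pK) ⟩
    count p K + 1                                 ≡⟨ +-comm (count p K) 1 ⟩
    suc (count p K)                               ∎
    where open ≡-Reasoning

  count-reject : ∀ {p K} → ¬ T (p (suc K)) → count p (suc K) ≡ count p K
  count-reject {p} {K} ¬pK = begin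
    count p (suc K)                               ≡⟨ count-suc p K ⟩
    count p K + length (filterᵇ p (suc K ∷ []))   ≡⟨ cong (λ xs → count p K + length xs) (filter-reject (T? ∘ p) ¬pK) ⟩
    count p K + 0                                 ≡⟨ +-identityʳ (count p K) ⟩
    count p K                                     ∎
    where open ≡-Reasoning

  module _ {p : ℕ → Bool} (downward-closed : ∀ k → T (p (suc k)) → T (p k)) where

    count-all : ∀ K → T (p K) → count p K ≡ K
    count-all zero _ = refl
    count-all (suc K) pK = trans (count-accept {p} pK) (cong suc (count-all K (downward-closed K pK)))

    count-threshold : T (p 0) → ∀ K → ¬ T (p K) → T (p (count p K)) × ¬ T (p (suc (count p K)))
    count-threshold p0 zero ¬p0 = contradiction p0 ¬p0
    count-threshold p0 (suc K) ¬pK rewrite count-reject {p} ¬pK with T? (p K)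
    ... | yes pK rewrite count-all K pK = pK , ¬pK
    ... | no ¬pK′ = count-threshold p0 K ¬pK′

  -- For 2m > n, the test (2m ∸ n)² ≤ 5n² in le-nφ is equivalent to 4m² ≤ 4n(m + n).
  le-nφ-spec : ∀ m n → T (le-nφ m n) ⇔ m * m ≤ n * (m + n)
  le-nφ-spec m n with 2 * m ≤? n
  ... | yes 2m≤n = mk⇔ (λ _ → m²≤n[m+n]) (λ _ → Equivalence.from T-∨ (inj₁ (≤⇒≤ᵇ 2m≤n)))
    where
    m≤n : m ≤ n
    m≤n = ≤-trans (m≤m+n m (m + 0)) 2m≤n
    m²≤n[m+n] : m * m ≤ n * (m + n)
    m²≤n[m+n] = ≤-trans (*-monoˡ-≤ m m≤n) (*-monoʳ-≤ n (m≤m+n m n))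
  ... | no 2m≰n with e , n+e≡2m ← m≤n⇒∃[o]m+o≡n (<⇒≤ (≰⇒> 2m≰n)) = mk⇔ to from
    where
    2m∸n≡e : 2 * m ∸ n ≡ e
    2m∸n≡e = trans (cong (_∸ n) (sym n+e≡2m)) (m+n∸m≡n n e)
    identity : e * e + 4 * (n * (m + n)) ≡ 4 * (m * m) + 5 * n * n
    identity = begin
      e * e + 4 * (n * (m + n))               ≡⟨ solve (m ∷ n ∷ e ∷ []) ⟩
      e * e + (2 * n * (2 * m) + 4 * n * n)   ≡⟨ cong (λ t → e * e + (2 * n * t + 4 * n * n)) n+e≡2m ⟨
      e * e + (2 * n * (n + e) + 4 * n * n)   ≡⟨ solve (n ∷ e ∷ []) ⟩
      (n + e) * (n + e) + 5 * n * n           ≡⟨ cong (λ t → t * t + 5 * n * n) n+e≡2m ⟩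
      2 * m * (2 * m) + 5 * n * n             ≡⟨ solve (m ∷ n ∷ []) ⟩
      4 * (m * m) + 5 * n * n                 ∎
      where open ≡-Reasoning
    to : T (le-nφ m n) → m * m ≤ n * (m + n)
    to t with Equivalence.to T-∨ t
    ... | inj₁ 2m≤ᵇn = contradiction (≤ᵇ⇒≤ (2 * m) n 2m≤ᵇn) 2m≰n
    ... | inj₂ e²≤ᵇ5n² = *-cancelˡ-≤ 4 (+-cross-≤ identity
            (subst (λ d → d * d ≤ 5 * n * n) 2m∸n≡e (≤ᵇ⇒≤ _ _ e²≤ᵇ5n²)))
    from : m * m ≤ n * (m + n) → T (le-nφ m n)
    from m²≤ = Equivalence.from T-∨ (inj₂ (≤⇒≤ᵇ
      (subst (λ d → d * d ≤ 5 * n * n) (sym 2m∸n≡e) (+-cross-≤ (sym identity) (*-monoʳ-≤ 4 m²≤)))))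

  le-nφ⇔¬Above : ∀ m n → T (le-nφ m n) ⇔ (¬ Above m n)
  le-nφ⇔¬Above m n = mk⇔
    (λ t (above h) → <⇒≱ h (Equivalence.to (le-nφ-spec m n) t))
    (λ ¬m>nφ → Equivalence.from (le-nφ-spec m n) (≮⇒≥ (¬m>nφ ∘ above)))

  a-threshold : ∀ n .{{_ : NonZero n}} → Below (a n) n × Above (suc (a n)) n
  a-threshold n =
    ¬Above⇒Below (to (a n) (proj₁ threshold)) , above (≰⇒> (proj₂ threshold ∘ Equivalence.from (le-nφ-spec (suc (a n)) n)))
    where
    to : ∀ m → T (le-nφ m n) → ¬ Above m n
    to m = Equivalence.to (le-nφ⇔¬Above m n)
    from : ∀ m → ¬ Above m n → T (le-nφ m n)
    from m = Equivalence.from (le-nφ⇔¬Above m n)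
    downward-closed : ∀ k → T (le-nφ (suc k) n) → T (le-nφ k n)
    downward-closed k t = from k (to (suc k) t ∘ Above-suc)
    2n>nφ : Above (2 * n) n
    2n>nφ = subst (λ k → Above k n) (cong (n +_) (sym (+-identityʳ n))) (Equivalence.from Above-reflect (≤⇒Below ≤-refl))
    threshold : T (le-nφ (a n) n) × ¬ T (le-nφ (suc (a n)) n)
    threshold = count-threshold downward-closed (from 0 λ ()) (2 * n) (λ t → to (2 * n) t 2n>nφ)

  Above-suc-a : ∀ n → Above (suc (a n)) n
  Above-suc-a zero = above z<s
  Above-suc-a n@(suc _) = proj₂ (a-threshold n)

  Below⇒≤a : ∀ {m n} → Below m n → m ≤ a n
  Below⇒≤a {m} {n} m<nφ = ≮⇒≥ λ a<m → Below⇒¬Above m<nφ (Above-monoˡ a<m (Above-suc-a n))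

  Above⇒a< : ∀ {m n} .{{_ : NonZero n}} → Above m n → a n < m
  Above⇒a< {m} {n} m>nφ = ≰⇒> λ m≤a → Below⇒¬Above (proj₁ (a-threshold n)) (Above-monoˡ m≤a m>nφ)

  a-unique : ∀ {m n} → Below m n → Above (suc m) n → a n ≡ m
  a-unique {n = suc _} m<nφ m+1>nφ = ≤-antisym (≤-pred (Above⇒a< m+1>nφ)) (Below⇒≤a m<nφ)

  a-<-suc : ∀ n → a n < a (suc n)
  a-<-suc zero = Below⇒≤a (≤⇒Below ≤-refl)
  a-<-suc n@(suc _) = Below⇒≤a (Below-suc (proj₁ (a-threshold n)))

  a-strictMono : ∀ {m n} → m < n → a m < a n
  a-strictMono m<n = go (≤⇒≤′ m<n)
    where
    go : ∀ {m n} → suc m ≤′ n → a m < a n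
    go {m} ≤′-refl = a-<-suc m
    go (≤′-step {n} m<′n) = <-trans (go m<′n) (a-<-suc n)

  -- b n = ⌊nφ²⌋, as φ² = φ + 1.
  b : ℕ → ℕ
  b n = a n + n

  b-threshold : ∀ n .{{_ : NonZero n}} → Above (b n) (a n) × Below (suc (b n)) (suc (a n))
  b-threshold n = Equivalence.from Above-reflect (proj₁ (a-threshold n))
                , Equivalence.from Below-reflect (proj₂ (a-threshold n))

  a∘a : ∀ n → a (a (suc n)) ≡ a (suc n) + n
  a∘a n = a-unique
    (Equivalence.from Below-reflect (Above-monoˡ (a-<-suc n) (Above-suc-a n)))
    (subst (λ k → Above k (a (suc n))) (+-suc (a (suc n)) n) (proj₁ (b-threshold (suc n))))

  a∘b : ∀ n → a (b (suc n)) ≡ b (suc n) + a (suc n)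
  a∘b n = a-unique
    (Equivalence.from Below-reflect (proj₁ (b-threshold (suc n))))
    (subst (λ k → Above k (b N)) (+-suc (b N) (a N))
      (Equivalence.from Above-reflect (Below-monoˡ (n≤1+n (b N)) (proj₂ (b-threshold N)))))
    where N = suc n

  b-unique : ∀ {m n} → Above (m + n) m → Below (suc (m + n)) (suc m) → a n ≡ m
  b-unique m+n>mφ m+n+1<[m+1]φ =
    a-unique (Equivalence.to Above-reflect m+n>mφ) (Equivalence.to Below-reflect m+n+1<[m+1]φ)

  between⇒a⊎b : ∀ {k d} → Above k d → Below k (suc d) →
    (a (suc d) ≡ k) ⊎ (∃[ n ] b (suc n) ≡ k)
  between⇒a⊎b {k} {d} k>dφ k<[d+1]φ with Below⊎Above (suc k) (suc d)
  ... | inj₂ k+1>[d+1]φ = inj₁ (a-unique k<[d+1]φ k+1>[d+1]φ)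
  ... | inj₁ k+1<[d+1]φ with o , d+1+o≡k ← m≤n⇒∃[o]m+o≡n (Above⇒> k>dφ) =
    inj₂ (o , trans (cong (_+ suc o) (b-unique (subst (λ x → Above x d) (sym e) k>dφ)
                                                (subst (λ x → Below (suc x) (suc d)) (sym e) k+1<[d+1]φ))) e)
    where
    e : d + suc o ≡ k
    e = trans (+-suc d o) d+1+o≡k

  beatty-cover : ∀ k → (∃[ n ] a (suc n) ≡ suc k) ⊎ (∃[ n ] b (suc n) ≡ suc k)
  beatty-cover k with d , k+d≡a ← m≤n⇒∃[o]m+o≡n (Below⇒≤a (≤⇒Below {suc k} ≤-refl)) =
    map₁ (d ,_) (between⇒a⊎b
      (Equivalence.to Below-reflect (subst (λ x → Below x K) (sym k+d≡a) (proj₁ (a-threshold K))))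
      (Equivalence.to Above-reflect (subst (λ x → Above x K) (sym (trans (+-suc K d) (cong suc k+d≡a))) (proj₂ (a-threshold K)))))
    where K = suc k

  a≢b : ∀ m n → a (suc m) ≢ b (suc n)
  a≢b m n a≡b = Below⇒¬Above (Below-monoʳ d<M (proj₂ (b-threshold (suc n)))) k+1>Mφ
    where
    M = suc m
    k+1>Mφ : Above (suc (b (suc n))) M
    k+1>Mφ = subst (λ k → Above (suc k) M) a≡b (proj₂ (a-threshold M))
    d<M : a (suc n) < M
    d<M = Above-Below⇒< (proj₁ (b-threshold (suc n))) (subst (λ k → Below k M) a≡b (proj₁ (a-threshold M)))

  f₀ : ℕ → ℕ → ℕ
  f₀ i n = F (suc i) * a n + F i * n

  F-suc-nonZero : ∀ i → NonZero (F (suc i))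
  F-suc-nonZero zero = _
  F-suc-nonZero (suc i) = >-nonZero (<-≤-trans (>-nonZero⁻¹ (F (suc i)) {{F-suc-nonZero i}}) (m≤m+n (F (suc i)) (F i)))

  f₀-strictMono : ∀ i {m n} → m < n → f₀ i m < f₀ i n
  f₀-strictMono i m<n = +-mono-<-≤
    (*-monoʳ-< (F (suc i)) {{F-suc-nonZero i}} (a-strictMono m<n)) (*-monoʳ-≤ (F i) (<⇒≤ m<n))

  f₀-injective : ∀ i {m n} → f₀ i m ≡ f₀ i n → m ≡ n
  f₀-injective i {m} {n} eq with <-cmp m n
  ... | tri< m<n _ _ = contradiction eq (<⇒≢ (f₀-strictMono i m<n))
  ... | tri≈ _ m≡n _ = m≡n
  ... | tri> _ _ m>n = contradiction (sym eq) (<⇒≢ (f₀-strictMono i m>n))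

  f₀-a : ∀ i n → f₀ i (a (suc n)) + F (suc i) ≡ f₀ (suc i) (suc n)
  f₀-a i n = begin
    F (suc i) * a (a N) + F i * a N + F (suc i)     ≡⟨ cong (λ x → F (suc i) * x + F i * a N + F (suc i)) (a∘a n) ⟩
    F (suc i) * (a N + n) + F i * a N + F (suc i)   ≡⟨ identity (F (suc i)) (F i) (a N) n ⟩
    (F (suc i) + F i) * a N + F (suc i) * N         ∎
    where
    open ≡-Reasoning
    N = suc n
    identity : ∀ p q m n → p * (m + n) + q * m + p ≡ (p + q) * m + p * suc n
    identity = solve-∀

  f₀-b : ∀ i n → f₀ i (b (suc n)) ≡ f₀ (suc (suc i)) (suc n)
  f₀-b i n = begin
    F (suc i) * a (a N + N) + F i * (a N + N)       ≡⟨ cong (λ x → F (suc i) * x + F i * (a N + N)) (a∘b n) ⟩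
    F (suc i) * (a N + N + a N) + F i * (a N + N)   ≡⟨ identity (F (suc i)) (F i) (a N) N ⟩
    (F (suc i) + F i + F (suc i)) * a N + (F (suc i) + F i) * N ∎
    where
    open ≡-Reasoning
    N = suc n
    identity : ∀ p q m n → p * (m + n + m) + q * (m + n) ≡ (p + q + p) * m + (p + q) * n
    identity = solve-∀

open import Data.Nat using (ℕ; suc)
open import Data.Integer using (ℤ; _+_; +_)
open import Data.Sum using (_⊎_)
open import Data.Product using (_×_)
open import Relation.Nullary using (¬_)
open import Function.Bundles using (_⇔_)

import Data.Nat as ℕ
open import Data.Nat using (z≤n; s≤s)
open import Data.Nat.Properties using (≤-trans; m≤n+m)
open import Data.Integer using (_-_; -_)
open import Data.Integer.Properties using (pos-+; +-injective; +-0-abelianGroup)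
open import Data.Integer.Tactic.RingSolver using (solve-∀)
open import Algebra.Properties.AbelianGroup +-0-abelianGroup using (∙-cancelʳ)
open import Data.Product using (_,_)
open import Data.Sum using (inj₁; inj₂) renaming (map to map-⊎)
open import Function.Bundles using (mk⇔)
open import Relation.Binary.PropositionalEquality
open Beatty

f-a : ∀ i j n → f i j (a (suc n)) ≡ f (suc i) (+ F (suc i) + j) (suc n)
f-a i j n = begin
  + f₀ i A - j                                     ≡⟨ shift (+ f₀ i A) (+ F (suc i)) j ⟩
  + f₀ i A + + F (suc i) - (+ F (suc i) + j)       ≡⟨ cong (_- (+ F (suc i) + j)) (pos-+ (f₀ i A) (F (suc i))) ⟨
  + (f₀ i A ℕ.+ F (suc i)) - (+ F (suc i) + j)     ≡⟨ cong (λ x → + x - (+ F (suc i) + j)) (f₀-a i n) ⟩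
  f (suc i) (+ F (suc i) + j) (suc n)              ∎
  where
  open ≡-Reasoning
  A = a (suc n)
  shift : ∀ x c j → x - j ≡ x + c - (c + j)
  shift = solve-∀

f-b : ∀ i j n → f i j (b (suc n)) ≡ f (suc (suc i)) j (suc n)
f-b i j n = cong (λ x → + x - j) (f₀-b i n)

f-injective : ∀ i j {m n} → f i j m ≡ f i j n → m ≡ n
f-injective i j {m} {n} eq = f₀-injective i (+-injective (∙-cancelʳ (- j) (+ f₀ i m) (+ f₀ i n) eq))

theorem2p3 : (i : ℕ) (j : ℤ) →
    ((x : ℤ) → InR i j x ⇔ (InR (suc i) (+ F (suc i) + j) x ⊎ InR (suc (suc i)) j x))
    × ((x : ℤ) → ¬ (InR (suc i) (+ F (suc i) + j) x × InR (suc (suc i)) j x))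
theorem2p3 i j = (λ x → mk⇔ (split x) (merge x)) , disjoint
  where
  split : ∀ x → InR i j x → InR (suc i) (+ F (suc i) + j) x ⊎ InR (suc (suc i)) j x
  split x (suc k , _ , fk≡x) = map-⊎
    (λ (n , ak≡k) → suc n , s≤s z≤n , trans (sym (f-a i j n)) (trans (cong (f i j) ak≡k) fk≡x))
    (λ (n , bn≡k) → suc n , s≤s z≤n , trans (sym (f-b i j n)) (trans (cong (f i j) bn≡k) fk≡x))
    (beatty-cover k)
  merge : ∀ x → InR (suc i) (+ F (suc i) + j) x ⊎ InR (suc (suc i)) j x → InR i j x
  merge x (inj₁ (suc n , _ , fn≡x)) = a (suc n) , ≤-trans (s≤s z≤n) (a-<-suc n) , trans (f-a i j n) fn≡x
  merge x (inj₂ (suc n , _ , fn≡x)) = b (suc n) , ≤-trans (s≤s z≤n) (m≤n+m (suc n) (a (suc n))) , trans (f-b i j n) fn≡x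
  disjoint : ∀ x → ¬ (InR (suc i) (+ F (suc i) + j) x × InR (suc (suc i)) j x)
  disjoint x ((suc m , _ , fm≡x) , (suc n , _ , fn≡x)) =
    a≢b m n (f-injective i j (trans (f-a i j m) (trans fm≡x (sym (trans (f-b i j n) fn≡x)))))
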